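{- Let $G$ be a simple, finite, connected graph, let $\{F_1,\ldots,F_k\}$ be a c-partition of $E(G)$, and for $i\in\{1,\ldots,k\}$ let $G_i=G/F_i$. Suppose $e=uv\in F_i$ for some $i\in\{1,\ldots,k\}$, let $U=\ell_i(u)$, $V=\ell_i(v)$, and suppose $E=UV\in E(G_i)$. Then $$M_u(e|G)=\Big(\bigcup_{X\in N_U(E|G_i)}E(X)\Big)\cup\Big(\bigcup_{F\in M_U(E|G_i)}\widehat{F}\Big),\qquad M_v(e|G)=\Big(\bigcup_{X\in N_V(E|G_i)}E(X)\Big)\cup\Big(\bigcup_{F\in M_V(E|G_i)}\widehat{F}\Big).$$
   Context: $d_G(u,v)$ is the shortest-path distance; for a vertex $u$ and an edge $f=xy$, $d_G(u,f)=\min\{d_G(u,x),d_G(u,y)\}$. For an edge $e=uv$ of a graph $H$: $N_u(e|H)=\{x\in V(H): d_H(u,x)<d_H(v,x)\}$ and $M_u(e|H)=\{f\in E(H): d_H(u,f)<d_H(v,f)\}$ (similarly with $u,v$ swapped). The Djoković–Winkler relation $\Theta$ on $E(G)$: $u_1v_1\,\Theta\,u_2v_2$ iff $d(u_1,u_2)+d(v_1,v_2)\neq d(u_1,v_2)+d(u_2,v_1)$; $\Theta^*$ is its transitive closure. A partition $\{F_1,\ldots,F_k\}$ of $E(G)$ is a c-partition if each $F_i$ is a union of one or more $\Theta^*$-classes. For $F\subseteq E(G)$, $G\setminus F$ is the graph obtained by deleting the edges of $F$; the quotient graph $G/F$ has as vertices the connected components of $G\setminus F$, two components $X,Y$ being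 adjacent if some vertex of $X$ is adjacent in $G$ to some vertex of $Y$. For an edge $E=XY$ of $G/F$, $\widehat{E}=\{xy\in E(G): x\in V(X),\ y\in V(Y)\}$. For $u\in V(G)$, $\ell_i(u)$ denotes the connected component of $G\setminus F_i$ containing $u$. For a component $X$, $E(X)$ is its edge set. -}

module Defs where

open import Data.Nat using (ℕ; zero; suc; _≤_; _<_; _+_; _⊓_)
open import Data.Fin using (Fin)
open import Data.Bool using (Bool; T; false)
open import Data.Product using (Σ; ∃; ∃₂; _×_; _,_; proj₁; proj₂)
open import Data.Sum using (_⊎_)
open import Relation.Binary.PropositionalEquality using (_≡_; _≢_)
open import Relation.Nullary using (¬_)
open import Relation.Binary.Construct.Closure.Transitive using (TransClosure)
open import Function.Bundles using (_⇔_)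

record Graph : Set where
  field
    n      : ℕ
    adj    : Fin n → Fin n → Bool
    adj-sym    : ∀ x y → adj x y ≡ adj y x
    adj-irrefl : ∀ x → adj x x ≡ false

data Walk {A : Set} (R : A → A → Set) : A → A → ℕ → Set where
  []  : ∀ {x} → Walk R x x 0
  _∷_ : ∀ {x y z k} → R x y → Walk R y z k → Walk R x z (suc k)

IsDist : {A : Set} → (A → A → ℕ → Set) → A → A → ℕ → Set
IsDist W x y k = W x y k × (∀ m → W x y m → k ≤ m)

DistLt : {A : Set} → (A → A → ℕ → Set) → A → A → A → Set
DistLt W x y z = ∃₂ λ a b → IsDist W x z a × IsDist W y z b × a < b

EDist : {A : Set} → (A → A → ℕ → Set) → A → A → A → ℕ → Set
EDist W x a b k = ∃₂ λ p q → IsDist W x a p × IsDist W x b q × k ≡ p ⊓ q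

EDistLt : {A : Set} → (A → A → ℕ → Set) → A → A → A → A → Set
EDistLt W x y a b = ∃₂ λ k l → EDist W x a b k × EDist W y a b l × k < l

module _ (G : Graph) where
  open Graph G

  V : Set
  V = Fin n

  Adj : V → V → Set
  Adj x y = T (adj x y)

  Connected : Set
  Connected = ∀ x y → ∃ λ k → Walk Adj x y k

  GWalk : V → V → ℕ → Set
  GWalk = Walk Adj

  Edge : Set
  Edge = Σ (V × V) λ p → Adj (proj₁ p) (proj₂ p)

  Θ : Edge → Edge → Set
  Θ ((u₁ , v₁) , _) ((u₂ , v₂) , _) =
    ∃₂ λ p q → ∃₂ λ r s →
      IsDist GWalk u₁ u₂ p × IsDist GWalk v₁ v₂ q ×
      IsDist GWalk u₁ v₂ r × IsDist GWalk u₂ v₁ s × (p + q ≢ r + s)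

  Θ* : Edge → Edge → Set
  Θ* = TransClosure Θ

  -- A partition {F_1,...,F_k} of E(G) given by a labelling c : an edge xy
  -- lies in F_i iff c x y ≡ i.  It is a c-partition iff every F_i is a
  -- nonempty union of Θ*-classes.
  record IsCPartition (k : ℕ) (c : V → V → Fin k) : Set where
    field
      c-sym      : ∀ x y → Adj x y → c x y ≡ c y x
      c-Θ*       : ∀ (e f : Edge) → Θ* e f →
                     c (proj₁ (proj₁ e)) (proj₂ (proj₁ e)) ≡ c (proj₁ (proj₁ f)) (proj₂ (proj₁ f))
      c-nonempty : ∀ i → ∃₂ λ x y → Adj x y × c x y ≡ i

  module _ {k : ℕ} (c : V → V → Fin k) (i : Fin k) where

    AdjMinus : V → V → Set
    AdjMinus x y = Adj x y × ¬ (c x y ≡ i)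

    -- Comp x y : y lies in ℓ_i(x), the component of G \ F_i containing x
    Comp : V → V → Set
    Comp x y = ∃ λ m → Walk AdjMinus x y m

    -- Adjacency in G/F_i of the components ℓ_i(x) and ℓ_i(y)
    -- (vertices of G/F_i are represented by any of their vertices)
    QAdj : V → V → Set
    QAdj x y = ¬ Comp x y × ∃₂ λ a b → Comp x a × Comp y b × Adj a b

    data QWalk : V → V → ℕ → Set where
      qstop : ∀ {x y} → Comp x y → QWalk x y 0
      qstep : ∀ {x z y m} → QAdj x z → QWalk z y m → QWalk x y (suc m)

-- Write F = F_i and F̄ for its complement, again a union of Θ*-classes.  On a geodesic from p to q the
-- number of F-edges equals d_{G/F}(ℓ(p), ℓ(q)).  This comes from the potential
-- φ_P(z) = Σ_{ab ∈ P ∩ F} (d(z,b) − d(z,a)) of a walk P: it is constant along edges outside F, which are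
-- not Θ-related to the edges of F, it changes by at most 2 across an F-edge, and from one end of a
-- geodesic P to the other it drops by twice the number of F-edges of P.  Hence d = d_{G/F} + d_{G/F̄}.
-- The term d_{G/F̄}(·, z) takes the same value at u and v, and is constant on every edge of F, so
-- comparing d(u, xy) with d(v, xy) reduces to comparing distances in G/F, inside the component of xy
-- when xy ∉ F and at its endpoints' components when xy ∈ F.
module Submission where

open import Defs
open import Data.Nat using (ℕ; zero; suc; _+_; _≤_; _<_; _⊓_; z≤n; s≤s; s≤s⁻¹)
open import Data.Nat.Properties
open import Data.Nat.Induction using (<-rec)
open import Data.Nat.Tactic.RingSolver using (solve-∀)
open import Data.Fin using (Fin; zero; suc)
import Data.Fin.Properties as Fin
open import Data.Bool using (T; if_then_else_)
open import Data.Product using (∃; ∃₂; _×_; _,_; proj₁; proj₂)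
open import Data.Sum using (_⊎_; inj₁; inj₂)
open import Data.Empty using (⊥; ⊥-elim)
open import Relation.Binary.PropositionalEquality
open import Relation.Nullary using (¬_; Dec; yes; no; does; contradiction)
open import Relation.Nullary.Decidable using (_×-dec_)
open import Relation.Nullary.Decidable.Core using (T?)
open import Relation.Binary.Construct.Closure.Transitive using ([_])
open import Function.Bundles using (_⇔_; mk⇔; Equivalence)
open Equivalence using (to; from)
open import Algebra.Properties.CommutativeSemigroup +-commutativeSemigroup using (interchange)

module _ {A : Set} {R : A → A → Set} where

  _++ʷ_ : ∀ {x y z m l} → Walk R x y m → Walk R y z l → Walk R x z (m + l)
  [] ++ʷ q = q
  (e ∷ p) ++ʷ q = e ∷ (p ++ʷ q)

  _∷ʳʷ_ : ∀ {x y z m} → Walk R x y m → R y z → Walk R x z (suc m)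
  [] ∷ʳʷ e = e ∷ []
  (e′ ∷ p) ∷ʳʷ e = e′ ∷ (p ∷ʳʷ e)

  reverseʷ : (∀ {x y} → R x y → R y x) → ∀ {x y m} → Walk R x y m → Walk R y x m
  reverseʷ sym-R [] = []
  reverseʷ sym-R (e ∷ p) = reverseʷ sym-R p ∷ʳʷ sym-R e

least : {P : ℕ → Set} → (∀ m → Dec (P m)) → ∀ k → P k → ∃ λ m → P m × (∀ j → P j → m ≤ j)
least {P} P? = <-rec _ go
  where
  go : ∀ k → (∀ {j} → j < k → P j → ∃ λ m → P m × (∀ j → P j → m ≤ j)) →
       P k → ∃ λ m → P m × (∀ j → P j → m ≤ j)
  go k rec pk with anyUpTo? P? k
  ... | yes (j , j<k , pj) = rec j<k pj
  ... | no none = k , pk , λ j pj → ≮⇒≥ (λ j<k → none (j , j<k , pj))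

+-double-cancel-≤ : ∀ m n → m + m ≤ n + n → m ≤ n
+-double-cancel-≤ m n m+m≤n+n = ≮⇒≥ λ n<m → <⇒≱ (+-mono-< n<m n<m) m+m≤n+n

+-cancelʳ-<-⇔ : ∀ a b h → a + h < b + h ⇔ a < b
+-cancelʳ-<-⇔ a b h = mk⇔ (+-cancelʳ-< h a b) (+-monoˡ-< h)

⊓-<-common-offsetˡ : ∀ {p q r s a b h₁ h₂} → p ≡ a + h₁ → q ≡ a + h₂ → r ≡ b + h₁ → s ≡ b + h₂ →
                     p ⊓ q < r ⊓ s ⇔ a < b
⊓-<-common-offsetˡ {a = a} {b} {h₁} {h₂} refl refl refl refl =
  subst₂ (λ p r → p < r ⇔ a < b) (+-distribˡ-⊓ a h₁ h₂) (+-distribˡ-⊓ b h₁ h₂) (+-cancelʳ-<-⇔ a b (h₁ ⊓ h₂))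

⊓-<-common-offsetʳ : ∀ {p q r s a₁ a₂ b₁ b₂ h} → p ≡ a₁ + h → q ≡ a₂ + h → r ≡ b₁ + h → s ≡ b₂ + h →
                     p ⊓ q < r ⊓ s ⇔ a₁ ⊓ a₂ < b₁ ⊓ b₂
⊓-<-common-offsetʳ {a₁ = a₁} {a₂} {b₁} {b₂} {h} refl refl refl refl =
  subst₂ (λ p r → p < r ⇔ a₁ ⊓ a₂ < b₁ ⊓ b₂) (+-distribʳ-⊓ h a₁ a₂) (+-distribʳ-⊓ h b₁ b₂)
         (+-cancelʳ-<-⇔ (a₁ ⊓ a₂) (b₁ ⊓ b₂) h)

module IsDist-properties {A : Set} (W : A → A → ℕ → Set) (D : A → A → ℕ)
                         (D-isDist : ∀ x y → IsDist W x y (D x y)) where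

  IsDist⇒≡ : ∀ {x y k} → IsDist W x y k → k ≡ D x y
  IsDist⇒≡ {x} {y} (w , k-min) = ≤-antisym (k-min _ (proj₁ (D-isDist x y))) (proj₂ (D-isDist x y) _ w)

  DistLt⇔ : ∀ {x y z} → DistLt W x y z ⇔ D x z < D y z
  DistLt⇔ {x} {y} {z} = mk⇔
    (λ (_ , _ , dx , dy , lt) → subst₂ _<_ (IsDist⇒≡ dx) (IsDist⇒≡ dy) lt)
    (λ lt → _ , _ , D-isDist x z , D-isDist y z , lt)

  EDistLt⇔ : ∀ {x y a b} → EDistLt W x y a b ⇔ D x a ⊓ D x b < D y a ⊓ D y b
  EDistLt⇔ {x} {y} {a} {b} = mk⇔
    (λ (_ , _ , (_ , _ , dxa , dxb , k≡) , (_ , _ , dya , dyb , l≡) , lt) →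
       subst₂ _<_ (trans k≡ (cong₂ _⊓_ (IsDist⇒≡ dxa) (IsDist⇒≡ dxb)))
                  (trans l≡ (cong₂ _⊓_ (IsDist⇒≡ dya) (IsDist⇒≡ dyb))) lt)
    (λ lt → _ , _ , (_ , _ , D-isDist x a , D-isDist x b , refl)
                  , (_ , _ , D-isDist y a , D-isDist y b , refl) , lt)

module GraphDistance (G : Graph) (conn : Connected G) where
  open Graph G

  adj-symmetric : ∀ {x y} → Adj G x y → Adj G y x
  adj-symmetric {x} {y} = subst T (adj-sym x y)

  walk? : ∀ m x y → Dec (GWalk G x y m)
  walk? zero x y with x Fin.≟ y
  ... | yes refl = yes []
  ... | no x≢y = no λ { [] → x≢y refl }
  walk? (suc m) x y with Fin.any? (λ z → T? (adj x z) ×-dec walk? m z y)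
  ... | yes (z , xz , w) = yes (xz ∷ w)
  ... | no none = no λ { (xz ∷ w) → none (_ , xz , w) }

  private
    shortest : ∀ x y → ∃ λ m → GWalk G x y m × (∀ j → GWalk G x y j → m ≤ j)
    shortest x y = least (λ m → walk? m x y) (proj₁ (conn x y)) (proj₂ (conn x y))

  d : V G → V G → ℕ
  d x y = proj₁ (shortest x y)

  geodesic : ∀ x y → GWalk G x y (d x y)
  geodesic x y = proj₁ (proj₂ (shortest x y))

  d-minimal : ∀ {x y} m → GWalk G x y m → d x y ≤ m
  d-minimal {x} {y} = proj₂ (proj₂ (shortest x y))

  d-isDist : ∀ x y → IsDist (GWalk G) x y (d x y)
  d-isDist x y = geodesic x y , d-minimal

  d-sym : ∀ x y → d x y ≡ d y x
  d-sym x y = ≤-antisym (d-minimal _ (reverseʷ adj-symmetric (geodesic y x)))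
                        (d-minimal _ (reverseʷ adj-symmetric (geodesic x y)))

  d-refl : ∀ x → d x x ≡ 0
  d-refl x = n≤0⇒n≡0 (d-minimal 0 [])

  d-adj-pos : ∀ {x y} → Adj G x y → 0 < d x y
  d-adj-pos {x} {y} xy with d x y | geodesic x y
  ... | zero | [] = ⊥-elim (subst T (adj-irrefl x) xy)
  ... | suc _ | _ = s≤s z≤n

  d-stepˡ : ∀ {x y} z → Adj G x y → d x z ≤ suc (d y z)
  d-stepˡ z xy = d-minimal _ (xy ∷ geodesic _ z)

  d-stepʳ : ∀ {x y} z → Adj G x y → d z y ≤ suc (d z x)
  d-stepʳ z xy = d-minimal _ (geodesic z _ ∷ʳʷ xy)

  ¬Θ⇒balanced : ∀ {x y a b} (xy : Adj G x y) (ab : Adj G a b) →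
                ¬ Θ G ((x , y) , xy) ((a , b) , ab) → d x a + d y b ≡ d y a + d x b
  ¬Θ⇒balanced {x} {y} {a} {b} xy ab ¬θ with d x a + d y b ≟ d x b + d a y
  ... | yes eq = trans eq (trans (+-comm (d x b) (d a y)) (cong (_+ d x b) (d-sym a y)))
  ... | no neq = contradiction (_ , _ , _ , _ , d-isDist x a , d-isDist y b , d-isDist x b , d-isDist a y , neq) ¬θ

module ΘClosedClass (G : Graph) (conn : Connected G) {k : ℕ} (c : V G → V G → Fin k) (i : Fin k)
    (c-sym : ∀ x y → Adj G x y → c x y ≡ c y x)
    (Θ-closed : ∀ {x y a b} (xy : Adj G x y) (ab : Adj G a b) →
                Θ G ((x , y) , xy) ((a , b) , ab) → (c x y ≡ i ⇔ c a b ≡ i)) where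
  open GraphDistance G conn

  InF : V G → V G → Set
  InF x y = c x y ≡ i

  inF? : ∀ x y → Dec (InF x y)
  inF? x y = c x y Fin.≟ i

  separated⇒balanced : ∀ {x y a b} (xy : Adj G x y) (ab : Adj G a b) →
                       ¬ (InF x y ⇔ InF a b) → d x a + d y b ≡ d y a + d x b
  separated⇒balanced xy ab sides = ¬Θ⇒balanced xy ab (λ θ → sides (Θ-closed xy ab θ))

  comp-refl : ∀ {x} → Comp G c i x x
  comp-refl = 0 , []

  comp-sym : ∀ {x y} → Comp G c i x y → Comp G c i y x
  comp-sym (m , w) = m , reverseʷ (λ (xy , xy∉F) → adj-symmetric xy , λ yx∈F → xy∉F (trans (c-sym _ _ xy) yx∈F)) w

  comp-trans : ∀ {x y z} → Comp G c i x y → Comp G c i y z → Comp G c i x z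
  comp-trans (m , w) (l , w′) = m + l , (w ++ʷ w′)

  comp-edge : ∀ {x y} → Adj G x y → ¬ InF x y → Comp G c i x y
  comp-edge xy xy∉F = 1 , ((xy , xy∉F) ∷ [])

  qwalk-precomp : ∀ {x y t m} → Comp G c i x y → QWalk G c i y t m → QWalk G c i x t m
  qwalk-precomp xy (qstop yt) = qstop (comp-trans xy yt)
  qwalk-precomp xy (qstep (y≁z , a , b , ya , zb , ab) W) =
    qstep ((λ xz → y≁z (comp-trans (comp-sym xy) xz)) , a , b , comp-trans xy ya , zb , ab) W

  qwalk-postcomp : ∀ {x y y′ m} → QWalk G c i x y m → Comp G c i y y′ → QWalk G c i x y′ m
  qwalk-postcomp (qstop xy) yy′ = qstop (comp-trans xy yy′)
  qwalk-postcomp (qstep q W) yy′ = qstep q (qwalk-postcomp W yy′)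

  onF : ∀ {a b} → Dec (InF a b) → ℕ → ℕ
  onF (yes _) r = r
  onF (no _) _ = 0

  Σfrom Σto : ∀ {s t m} → GWalk G s t m → V G → ℕ
  Σfrom [] z = 0
  Σfrom (_∷_ {x = a} {y = b} _ P) z = onF (inF? a b) (d z a) + Σfrom P z
  Σto [] z = 0
  Σto (_∷_ {x = a} {y = b} _ P) z = onF (inF? a b) (d z b) + Σto P z

  #F : ∀ {s t m} → GWalk G s t m → ℕ
  #F [] = 0
  #F (_∷_ {x = a} {y = b} _ P) = onF (inF? a b) 1 + #F P

  potential-flat : ∀ {s t m} (P : GWalk G s t m) {x y} → Adj G x y → ¬ InF x y →
                   Σfrom P x + Σto P y ≡ Σfrom P y + Σto P x
  potential-flat [] xy xy∉F = refl
  potential-flat (_∷_ {x = a} {y = b} ab P) {x} {y} xy xy∉F with inF? a b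
  ... | no _ = potential-flat P xy xy∉F
  ... | yes ab∈F = begin
    (d x a + Σfrom P x) + (d y b + Σto P y) ≡⟨ interchange (d x a) (Σfrom P x) (d y b) (Σto P y) ⟩
    (d x a + d y b) + (Σfrom P x + Σto P y) ≡⟨ cong₂ _+_ balanced (potential-flat P xy xy∉F) ⟩
    (d y a + d x b) + (Σfrom P y + Σto P x) ≡⟨ interchange (d y a) (d x b) (Σfrom P y) (Σto P x) ⟩
    (d y a + Σfrom P y) + (d x b + Σto P x) ∎
    where
    open ≡-Reasoning
    balanced = separated⇒balanced xy ab (λ sides → xy∉F (from sides ab∈F))

  potential-across-F : ∀ {s t m} (P : GWalk G s t m) {x y} → Adj G x y → InF x y →
                       Σto P y + Σfrom P x + d y s + d x t ≡ Σfrom P y + Σto P x + d y t + d x s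
  potential-across-F [] xy xy∈F = refl
  potential-across-F {s} {t} (_∷_ {y = b} sb P) {x} {y} xy xy∈F with inF? s b
  ... | yes _ = begin
    (d y b + Σto P y) + (d x s + Σfrom P x) + d y s + d x t ≡⟨ rearrange (d y b) (Σto P y) (d x s) (Σfrom P x) (d y s) (d x t) ⟩
    (Σto P y + Σfrom P x + d y b + d x t) + (d x s + d y s) ≡⟨ cong (_+ (d x s + d y s)) ih ⟩
    (Σfrom P y + Σto P x + d y t + d x b) + (d x s + d y s) ≡⟨ rearrange′ (Σfrom P y) (Σto P x) (d y t) (d x b) (d x s) (d y s) ⟩
    (d y s + Σfrom P y) + (d x b + Σto P x) + d y t + d x s ∎
    where
    open ≡-Reasoning
    ih = potential-across-F P xy xy∈F
    rearrange : ∀ a b c e f g → (a + b) + (c + e) + f + g ≡ (b + e + a + g) + (c + f)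
    rearrange = solve-∀
    rearrange′ : ∀ a b c e f g → (a + b + c + e) + (f + g) ≡ (g + a) + (e + b) + c + f
    rearrange′ = solve-∀
  ... | no sb∉F = +-cancelʳ-≡ (d x b) _ _ (begin
    Σto P y + Σfrom P x + d y s + d x t + d x b ≡⟨ rearrange (Σto P y) (Σfrom P x) (d y s) (d x t) (d x b) ⟩
    (Σto P y + Σfrom P x + d x t) + (d y s + d x b) ≡⟨ cong (Σto P y + Σfrom P x + d x t +_) (sym balanced) ⟩
    (Σto P y + Σfrom P x + d x t) + (d x s + d y b) ≡⟨ rearrange′ (Σto P y) (Σfrom P x) (d x t) (d x s) (d y b) ⟩
    (Σto P y + Σfrom P x + d y b + d x t) + d x s ≡⟨ cong (_+ d x s) (potential-across-F P xy xy∈F) ⟩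
    (Σfrom P y + Σto P x + d y t + d x b) + d x s ≡⟨ +-comm-last (Σfrom P y + Σto P x + d y t) (d x b) (d x s) ⟩
    Σfrom P y + Σto P x + d y t + d x s + d x b ∎)
    where
    open ≡-Reasoning
    balanced = separated⇒balanced xy sb (λ sides → sb∉F (to sides xy∈F))
    rearrange : ∀ a b c e f → a + b + c + e + f ≡ (a + b + e) + (c + f)
    rearrange = solve-∀
    rearrange′ : ∀ a b c e f → (a + b + c) + (e + f) ≡ (a + b + f + c) + e
    rearrange′ = solve-∀
    +-comm-last : ∀ a b c → a + b + c ≡ a + c + b
    +-comm-last = solve-∀

  -- Drop P x y k  says  φ x ≤ φ y + k  for the potential φ = Σto P − Σfrom P, stated without subtraction.
  Drop : ∀ {s t m} → GWalk G s t m → V G → V G → ℕ → Set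
  Drop P x y k = Σfrom P y + Σto P x ≤ Σfrom P x + Σto P y + k

  drop-trans : ∀ {s t m} (P : GWalk G s t m) {x y z} k l → Drop P x y k → Drop P y z l → Drop P x z (k + l)
  drop-trans P {x} {y} {z} k l xy yz = +-cancelʳ-≤ (Σfrom P y + Σto P y) _ _ (begin
    Σfrom P z + Σto P x + (Σfrom P y + Σto P y) ≡⟨ rearrange (Σfrom P z) (Σto P x) (Σfrom P y) (Σto P y) ⟩
    (Σfrom P y + Σto P x) + (Σfrom P z + Σto P y) ≤⟨ +-mono-≤ xy yz ⟩
    (Σfrom P x + Σto P y + k) + (Σfrom P y + Σto P z + l)
      ≡⟨ rearrange′ (Σfrom P x) (Σto P y) k (Σfrom P y) (Σto P z) l ⟩
    Σfrom P x + Σto P z + (k + l) + (Σfrom P y + Σto P y) ∎)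
    where
    open ≤-Reasoning
    rearrange : ∀ a b e f → a + b + (e + f) ≡ (e + b) + (a + f)
    rearrange = solve-∀
    rearrange′ : ∀ a b k e f l → (a + b + k) + (e + f + l) ≡ a + f + (k + l) + (e + b)
    rearrange′ = solve-∀

  drop-across-F : ∀ {s t m} (P : GWalk G s t m) {x y} → Adj G x y → InF x y → Drop P x y 2
  drop-across-F {s} {t} P {x} {y} xy xy∈F = +-cancelʳ-≤ (d y t + d x s) _ _ (begin
    Σfrom P y + Σto P x + (d y t + d x s) ≡⟨ rearrange (Σfrom P y) (Σto P x) (d y t) (d x s) ⟩
    Σfrom P y + Σto P x + d y t + d x s ≡⟨ sym (potential-across-F P xy xy∈F) ⟩
    Σto P y + Σfrom P x + d y s + d x t ≤⟨ +-mono-≤ (+-monoʳ-≤ _ (d-stepˡ s (adj-symmetric xy))) (d-stepˡ t xy) ⟩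
    Σto P y + Σfrom P x + suc (d x s) + suc (d y t) ≡⟨ rearrange′ (Σto P y) (Σfrom P x) (d x s) (d y t) ⟩
    Σfrom P x + Σto P y + 2 + (d y t + d x s) ∎)
    where
    open ≤-Reasoning
    rearrange : ∀ a b e f → a + b + (e + f) ≡ a + b + e + f
    rearrange = solve-∀
    rearrange′ : ∀ a b e f → a + b + suc e + suc f ≡ b + a + 2 + (f + e)
    rearrange′ = solve-∀

  comp⇒drop₀ : ∀ {s t m} (P : GWalk G s t m) {x y l} → Walk (AdjMinus G c i) x y l → Drop P x y 0
  comp⇒drop₀ P [] = ≤-reflexive (sym (+-identityʳ _))
  comp⇒drop₀ P ((xa , xa∉F) ∷ w) =
    drop-trans P 0 0 (≤-reflexive (trans (sym (potential-flat P xa xa∉F)) (sym (+-identityʳ _))))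
                     (comp⇒drop₀ P w)

  F-edge-crosses : ∀ {a b} → Adj G a b → InF a b → ¬ Comp G c i a b
  F-edge-crosses {a} {b} ab ab∈F (_ , w) = contradict (inF? a b) (comp⇒drop₀ (ab ∷ []) w)
    where
    contradict : (dec : Dec (InF a b)) →
                 onF dec (d b a) + 0 + (onF dec (d a b) + 0) ≤ onF dec (d a a) + 0 + (onF dec (d b b) + 0) + 0 → ⊥
    contradict (no ab∉F) _ = ab∉F ab∈F
    contradict (yes _) le = <⇒≱ (d-adj-pos ab) (begin
      d a b ≤⟨ m≤m+n (d a b) 0 ⟩
      d a b + 0 ≤⟨ m≤n+m _ (d b a + 0) ⟩
      d b a + 0 + (d a b + 0) ≤⟨ le ⟩
      d a a + 0 + (d b b + 0) + 0 ≡⟨ cong₂ (λ p q → p + 0 + (q + 0) + 0) (d-refl a) (d-refl b) ⟩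
      0 ∎)
      where open ≤-Reasoning

  crossing-edge∈F : ∀ {x z a b} → ¬ Comp G c i x z → Comp G c i x a → Comp G c i z b → Adj G a b → InF a b
  crossing-edge∈F {a = a} {b} x≁z xa zb ab with inF? a b
  ... | yes ab∈F = ab∈F
  ... | no ab∉F = contradiction (comp-trans xa (comp-trans (comp-edge ab ab∉F) (comp-sym zb))) x≁z

  qwalk⇒drop : ∀ {s t m} (P : GWalk G s t m) {x y l} → QWalk G c i x y l → Drop P x y (l + l)
  qwalk⇒drop P (qstop (_ , w)) = comp⇒drop₀ P w
  qwalk⇒drop P {x} {y} (qstep {m = l} (x≁z , a , b , xa , zb , ab) W) =
    subst (Drop P x y) (cong suc (sym (+-suc l l)))
      (drop-trans P 2 (l + l)
        (drop-trans P 2 0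
          (drop-trans P 0 2 (comp⇒drop₀ P (proj₂ xa)) (drop-across-F P ab (crossing-edge∈F x≁z xa zb ab)))
          (comp⇒drop₀ P (proj₂ (comp-sym zb))))
        (qwalk⇒drop P W))

  project : ∀ {s t m} (P : GWalk G s t m) → QWalk G c i s t (#F P)
  project [] = qstop comp-refl
  project (_∷_ {x = a} {y = b} ab P) with inF? a b
  ... | yes ab∈F = qstep (F-edge-crosses ab ab∈F , a , b , comp-refl , comp-refl , ab) (project P)
  ... | no ab∉F = qwalk-precomp (comp-edge ab ab∉F) (project P)

  recede-step : ∀ {w s b t m} → Adj G s b → GWalk G b t m → d w t ≡ d w s + suc m → d w b ≡ suc (d w s)
  recede-step {w} {s} {b} {t} {m} sb P tight = ≤-antisym (d-stepʳ w sb) (+-cancelʳ-≤ m _ _ (begin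
    suc (d w s) + m ≡⟨ sym (+-suc (d w s) m) ⟩
    d w s + suc m   ≡⟨ sym tight ⟩
    d w t           ≤⟨ d-minimal _ (geodesic w b ++ʷ P) ⟩
    d w b + m       ∎))
    where open ≤-Reasoning

  approach-step : ∀ {w s b t m} → Adj G s b → GWalk G b t m → d w s ≡ suc m + d w t → d w b ≡ m + d w t
  approach-step {w} {s} {b} {t} {m} sb P tight = ≤-antisym
    (≤-trans (d-minimal _ (geodesic w t ++ʷ reverseʷ adj-symmetric P)) (≤-reflexive (+-comm (d w t) m)))
    (s≤s⁻¹ (≤-trans (≤-reflexive (sym tight)) (d-stepʳ w (adj-symmetric sb))))

  Σto-receding : ∀ {s t m} w (P : GWalk G s t m) → d w t ≡ d w s + m → Σto P w ≡ Σfrom P w + #F P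
  Σto-receding w [] _ = refl
  Σto-receding {s} w (_∷_ {y = b} {k = m} sb P) tight = count (inF? s b)
    where
    step : d w b ≡ suc (d w s)
    step = recede-step sb P tight
    ih : Σto P w ≡ Σfrom P w + #F P
    ih = Σto-receding w P (trans tight (trans (+-suc (d w s) m) (cong (_+ m) (sym step))))
    rearrange : ∀ a b e → suc a + (b + e) ≡ (a + b) + (1 + e)
    rearrange = solve-∀
    count : (dec : Dec (InF s b)) → onF dec (d w b) + Σto P w ≡ (onF dec (d w s) + Σfrom P w) + (onF dec 1 + #F P)
    count (yes _) = trans (cong₂ _+_ step ih) (rearrange (d w s) (Σfrom P w) (#F P))
    count (no _) = ih

  Σfrom-approaching : ∀ {s t m} w (P : GWalk G s t m) → d w s ≡ m + d w t → Σfrom P w ≡ Σto P w + #F P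
  Σfrom-approaching w [] _ = refl
  Σfrom-approaching {s} {t} w (_∷_ {y = b} {k = m} sb P) tight = count (inF? s b)
    where
    step : d w b ≡ m + d w t
    step = approach-step sb P tight
    ih : Σfrom P w ≡ Σto P w + #F P
    ih = Σfrom-approaching w P step
    rearrange : ∀ a b e → suc a + (b + e) ≡ (a + b) + (1 + e)
    rearrange = solve-∀
    count : (dec : Dec (InF s b)) → onF dec (d w s) + Σfrom P w ≡ (onF dec (d w b) + Σto P w) + (onF dec 1 + #F P)
    count (yes _) = trans (cong₂ _+_ (trans tight (cong suc (sym step))) ih) (rearrange (d w b) (Σto P w) (#F P))
    count (no _) = ih

  #F-geodesic-≤ : ∀ {s t l} (P : GWalk G s t (d s t)) → QWalk G c i s t l → #F P ≤ l
  #F-geodesic-≤ {s} {t} {l} P W = +-double-cancel-≤ (#F P) l (+-cancelʳ-≤ (Σfrom P s + Σto P t) _ _ (begin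
    #F P + #F P + (Σfrom P s + Σto P t)   ≡⟨ rearrange (#F P) (Σfrom P s) (Σto P t) ⟩
    (Σto P t + #F P) + (Σfrom P s + #F P) ≡⟨ cong₂ _+_ (sym at-t) (sym at-s) ⟩
    Σfrom P t + Σto P s                   ≤⟨ qwalk⇒drop P W ⟩
    Σfrom P s + Σto P t + (l + l)         ≡⟨ +-comm (Σfrom P s + Σto P t) (l + l) ⟩
    l + l + (Σfrom P s + Σto P t)         ∎))
    where
    open ≤-Reasoning
    rearrange : ∀ f a b → f + f + (a + b) ≡ (b + f) + (a + f)
    rearrange = solve-∀
    at-s : Σto P s ≡ Σfrom P s + #F P
    at-s = Σto-receding s P (sym (cong (_+ d s t) (d-refl s)))
    at-t : Σfrom P t ≡ Σto P t + #F P
    at-t = Σfrom-approaching t P (trans (d-sym t s) (sym (trans (cong (d s t +_) (d-refl t)) (+-identityʳ _))))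

  dF : V G → V G → ℕ
  dF p q = #F (geodesic p q)

  dF-isDist : ∀ p q → IsDist (QWalk G c i) p q (dF p q)
  dF-isDist p q = project (geodesic p q) , λ _ → #F-geodesic-≤ (geodesic p q)

  open IsDist-properties (QWalk G c i) dF dF-isDist public

  dF-compʳ : ∀ {z a a′} → Comp G c i a a′ → dF z a ≡ dF z a′
  dF-compʳ {z} {a} aa′ = IsDist⇒≡
    (qwalk-postcomp (project (geodesic z a)) aa′ , λ _ W → #F-geodesic-≤ (geodesic z a) (qwalk-postcomp W (comp-sym aa′)))

  dF-compˡ : ∀ {z z′ a} → Comp G c i z z′ → dF z a ≡ dF z′ a
  dF-compˡ {z} {a = a} zz′ = IsDist⇒≡
    (qwalk-precomp (comp-sym zz′) (project (geodesic z a)) , λ _ W → #F-geodesic-≤ (geodesic z a) (qwalk-precomp zz′ W))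

module _ (G : Graph) (conn : Connected G) {k : ℕ} (c : V G → V G → Fin k) (cp : IsCPartition G k c) (i : Fin k) where
  open GraphDistance G conn
  open IsCPartition cp

  private
    Θ-respects-c : ∀ {x y a b} (xy : Adj G x y) (ab : Adj G a b) → Θ G ((x , y) , xy) ((a , b) , ab) → c x y ≡ c a b
    Θ-respects-c {x} {y} {a} {b} xy ab θ = c-Θ* ((x , y) , xy) ((a , b) , ab) [ θ ]

    ≡-resp-⇔ : ∀ {A : Set} {p q j : A} → p ≡ q → (p ≡ j ⇔ q ≡ j)
    ≡-resp-⇔ p≡q = mk⇔ (trans (sym p≡q)) (trans p≡q)

    -- The complement of F_i, as class 1 of a two-class labelling; it is again a union of Θ*-classes.
    outside : Fin k → Fin 2
    outside j = if does (j Fin.≟ i) then zero else suc zero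

    outside≡1⇔ : ∀ j → outside j ≡ suc zero ⇔ (¬ j ≡ i)
    outside≡1⇔ j with j Fin.≟ i
    ... | yes j≡i = mk⇔ (λ ()) (contradiction j≡i)
    ... | no j≢i = mk⇔ (λ _ → j≢i) (λ _ → refl)

    c̄ : V G → V G → Fin 2
    c̄ x y = outside (c x y)

  module F = ΘClosedClass G conn c i c-sym (λ xy ab θ → ≡-resp-⇔ (Θ-respects-c xy ab θ))
  module F̄ = ΘClosedClass G conn c̄ (suc zero) (λ x y xy → cong outside (c-sym x y xy))
                          (λ xy ab θ → ≡-resp-⇔ (cong outside (Θ-respects-c xy ab θ)))

  #F+#F̄ : ∀ {s t m} (P : GWalk G s t m) → F.#F P + F̄.#F P ≡ m
  #F+#F̄ [] = refl
  #F+#F̄ {m = suc m} (_∷_ {x = a} {y = b} _ P) = count (F.inF? a b) (F̄.inF? a b)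
    where
    count : (dec : Dec (F.InF a b)) (dec̄ : Dec (F̄.InF a b)) →
            F.onF dec 1 + F.#F P + (F̄.onF dec̄ 1 + F̄.#F P) ≡ suc m
    count (yes ab∈F) (yes ab∈F̄) = contradiction ab∈F (to (outside≡1⇔ (c a b)) ab∈F̄)
    count (yes _) (no _) = cong suc (#F+#F̄ P)
    count (no _) (yes _) = trans (+-suc (F.#F P) (F̄.#F P)) (cong suc (#F+#F̄ P))
    count (no ab∉F) (no ab∉F̄) = contradiction (from (outside≡1⇔ (c a b)) ab∉F) ab∉F̄

  d≡dF+dF̄ : ∀ p q → d p q ≡ F.dF p q + F̄.dF p q
  d≡dF+dF̄ p q = sym (#F+#F̄ (geodesic p q))

  F-edge⇒comp̄ : ∀ {x y} → Adj G x y → c x y ≡ i → Comp G c̄ (suc zero) x y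
  F-edge⇒comp̄ xy xy∈F = F̄.comp-edge xy (λ xy∈F̄ → to (outside≡1⇔ _) xy∈F̄ xy∈F)

  InCloserComponent OverCloserEdge : V G → V G → V G → V G → Set
  InCloserComponent u v x y =
    ∃ λ w → Comp G c i w x × Comp G c i w y × AdjMinus G c i x y × DistLt (QWalk G c i) u v w
  OverCloserEdge u v x y =
    ∃₂ λ a b → QAdj G c i a b × EDistLt (QWalk G c i) u v a b
      × ((Comp G c i a x × Comp G c i b y) ⊎ (Comp G c i a y × Comp G c i b x))

  M-decomposition : V G → V G → Set
  M-decomposition u v = ∀ x y → Adj G x y →
    (EDistLt (GWalk G) u v x y ⇔ (InCloserComponent u v x y ⊎ OverCloserEdge u v x y))

  private module dG = IsDist-properties (GWalk G) d d-isDist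

  F-edge-M-decomposition : ∀ {u v} → Adj G u v → c u v ≡ i → M-decomposition u v
  F-edge-M-decomposition {u} {v} uv uv∈F x y xy = mk⇔ forward backward
    where
    dF̄-uv : ∀ z → F̄.dF u z ≡ F̄.dF v z
    dF̄-uv z = F̄.dF-compˡ (F-edge⇒comp̄ uv uv∈F)

    compare-within : ∀ {w} → Comp G c i w x → Comp G c i w y →
                     d u x ⊓ d u y < d v x ⊓ d v y ⇔ F.dF u w < F.dF v w
    compare-within wx wy = ⊓-<-common-offsetˡ
      (trans (d≡dF+dF̄ u x) (cong (_+ F̄.dF u x) (sym (F.dF-compʳ wx))))
      (trans (d≡dF+dF̄ u y) (cong (_+ F̄.dF u y) (sym (F.dF-compʳ wy))))
      (trans (d≡dF+dF̄ v x) (cong₂ _+_ (sym (F.dF-compʳ wx)) (sym (dF̄-uv x))))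
      (trans (d≡dF+dF̄ v y) (cong₂ _+_ (sym (F.dF-compʳ wy)) (sym (dF̄-uv y))))

    compare-across : c x y ≡ i → d u x ⊓ d u y < d v x ⊓ d v y ⇔ F.dF u x ⊓ F.dF u y < F.dF v x ⊓ F.dF v y
    compare-across xy∈F = ⊓-<-common-offsetʳ
      (d≡dF+dF̄ u x)
      (trans (d≡dF+dF̄ u y) (cong (F.dF u y +_) (sym dF̄-xy)))
      (trans (d≡dF+dF̄ v x) (cong (F.dF v x +_) (sym (dF̄-uv x))))
      (trans (d≡dF+dF̄ v y) (cong (F.dF v y +_) (trans (sym (dF̄-uv y)) (sym dF̄-xy))))
      where
      dF̄-xy : F̄.dF u x ≡ F̄.dF u y
      dF̄-xy = F̄.dF-compʳ (F-edge⇒comp̄ xy xy∈F)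

    closer-over : ∀ {a b} → Comp G c i a x → Comp G c i b y →
                  F.dF u a ⊓ F.dF u b < F.dF v a ⊓ F.dF v b → F.dF u x ⊓ F.dF u y < F.dF v x ⊓ F.dF v y
    closer-over ax by = subst₂ _<_ (cong₂ _⊓_ (F.dF-compʳ ax) (F.dF-compʳ by)) (cong₂ _⊓_ (F.dF-compʳ ax) (F.dF-compʳ by))

    forward : EDistLt (GWalk G) u v x y → InCloserComponent u v x y ⊎ OverCloserEdge u v x y
    forward closer with F.inF? x y
    ... | no xy∉F = inj₁ (x , F.comp-refl , F.comp-edge xy xy∉F , (xy , xy∉F) ,
      from F.DistLt⇔ (to (compare-within F.comp-refl (F.comp-edge xy xy∉F)) (to dG.EDistLt⇔ closer)))
    ... | yes xy∈F = inj₂ (x , y , (F.F-edge-crosses xy xy∈F , x , y , F.comp-refl , F.comp-refl , xy) ,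
      from F.EDistLt⇔ (to (compare-across xy∈F) (to dG.EDistLt⇔ closer)) , inj₁ (F.comp-refl , F.comp-refl))

    backward : InCloserComponent u v x y ⊎ OverCloserEdge u v x y → EDistLt (GWalk G) u v x y
    backward (inj₁ (w , wx , wy , _ , closer)) =
      from dG.EDistLt⇔ (from (compare-within wx wy) (to F.DistLt⇔ closer))
    backward (inj₂ (a , b , (a≁b , _) , closer , inj₁ (ax , by))) =
      from dG.EDistLt⇔ (from (compare-across (F.crossing-edge∈F a≁b ax by xy))
                             (closer-over ax by (to F.EDistLt⇔ closer)))
    backward (inj₂ (a , b , (a≁b , _) , closer , inj₂ (ay , bx))) =
      from dG.EDistLt⇔ (from (compare-across (F.crossing-edge∈F (λ ba → a≁b (F.comp-sym ba)) bx ay xy))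
                             (closer-over bx ay (subst₂ _<_ (⊓-comm _ _) (⊓-comm _ _) (to F.EDistLt⇔ closer))))

lemma3p2 : (G : Graph) → Connected G →
    (k : ℕ) (c : V G → V G → Fin k) → IsCPartition G k c →
    (i : Fin k) (u v : V G) → Adj G u v → c u v ≡ i →
    QAdj G c i u v →
    (∀ x y → Adj G x y →
      (EDistLt (GWalk G) u v x y ⇔
        ((∃ λ w → Comp G c i w x × Comp G c i w y × AdjMinus G c i x y × DistLt (QWalk G c i) u v w)
         ⊎ (∃₂ λ a b → QAdj G c i a b × EDistLt (QWalk G c i) u v a b
              × ((Comp G c i a x × Comp G c i b y) ⊎ (Comp G c i a y × Comp G c i b x))))))
    ×
    (∀ x y → Adj G x y →
      (EDistLt (GWalk G) v u x y ⇔
        ((∃ λ w → Comp G c i w x × Comp G c i w y × AdjMinus G c i x y × DistLt (QWalk G c i) v u w)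
         ⊎ (∃₂ λ a b → QAdj G c i a b × EDistLt (QWalk G c i) v u a b
              × ((Comp G c i a x × Comp G c i b y) ⊎ (Comp G c i a y × Comp G c i b x))))))
-- The hypothesis that U and V are adjacent in G/F_i is implied by e ∈ F_i (F-edge-crosses).
lemma3p2 G conn k c cp i u v uv uv∈F _ =
    F-edge-M-decomposition G conn c cp i uv uv∈F
  , F-edge-M-decomposition G conn c cp i (adj-symmetric uv) (trans (sym (c-sym u v uv)) uv∈F)
  where
  open GraphDistance G conn using (adj-symmetric)
  open IsCPartition cp using (c-sym)
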